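{- Let $r$ be a positive integer, let $G$ be a $K_{3,r}$-minor-free graph, let $I_s,I_t$ be independent sets of $G$, $X:=I_s\cup I_t$, and fix distinct $x,x'\in X$. Let $C:=\mathcal{C}_{\{x,x'\}}$. Then every connected component of $G[V(G)\setminus(C\cup\{x,x'\})]$ is adjacent to at most $r-1$ vertices of $C$.
   Context: For $Y\subseteq X$, $\mathcal{C}_Y:=\{v\in V(G)\setminus X : N(v)\cap X=Y\}$. A component is adjacent to a vertex $v$ if some vertex of the component is adjacent to $v$. -}

module Defs where

open import Data.Nat using (ℕ; _+_)
open import Data.Bool using (Bool; true; false; _xor_)
open import Data.Bool.Properties using (xor-comm; xor-same)
open import Data.Fin using (Fin; splitAt)
open import Data.Fin.Subset using (Subset; _∈_; _∉_; Nonempty)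
open import Data.Sum using (_⊎_; inj₁; inj₂)
open import Data.Product using (Σ; ∃; ∃-syntax; _×_; _,_)
open import Function.Definitions using (Injective)
open import Relation.Binary.PropositionalEquality using (_≡_; _≢_)
open import Relation.Nullary using (¬_)

record Graph (n : ℕ) : Set where
  field
    adj    : Fin n → Fin n → Bool
    adj-sym    : ∀ u v → adj u v ≡ adj v u
    adj-irrefl : ∀ u → adj u u ≡ false
open Graph public

E : ∀ {n} → Graph n → Fin n → Fin n → Set
E G u v = adj G u v ≡ true

data Reach {n : ℕ} (G : Graph n) (S : Fin n → Set) (u : Fin n) : Fin n → Set where
  here : S u → Reach G S u u
  step : ∀ {w v} → Reach G S u w → E G w v → S v → Reach G S u v

Connected : ∀ {n} → Graph n → Subset n → Set
Connected G S = ∀ u v → u ∈ S → v ∈ S → Reach G (λ w → w ∈ S) u v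

side : ∀ a {b} → Fin (a + b) → Bool
side a i with splitAt a i
... | inj₁ _ = true
... | inj₂ _ = false

K : (a b : ℕ) → Graph (a + b)
K a b = record
  { adj = λ i j → side a i xor side a j
  ; adj-sym = λ i j → xor-comm (side a i) (side a j)
  ; adj-irrefl = λ i → xor-same (side a i)
  }

record MinorModel {m n : ℕ} (H : Graph m) (G : Graph n) : Set where
  field
    branch    : Fin m → Subset n
    nonempty  : ∀ i → Nonempty (branch i)
    connected : ∀ i → Connected G (branch i)
    disjoint  : ∀ i j → i ≢ j → ∀ v → v ∈ branch i → v ∉ branch j
    edges     : ∀ i j → E H i j →
                ∃[ u ] ∃[ v ] (u ∈ branch i × v ∈ branch j × E G u v)

HasMinor : ∀ {m n} → Graph m → Graph n → Set
HasMinor H G = MinorModel H G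

MinorFree : ∀ {m n} → Graph m → Graph n → Set
MinorFree H G = ¬ HasMinor H G

IndependentSet : ∀ {n} → Graph n → Subset n → Set
IndependentSet G I = ∀ u v → u ∈ I → v ∈ I → ¬ E G u v

-- Neighbourhood-class:  C_Y := { v ∉ X : N(v) ∩ X = Y },  with X given as a predicate
-- and Y as a predicate contained in X.
InClass : ∀ {n} → Graph n → (X : Fin n → Set) → (Y : Fin n → Set) → Fin n → Set
InClass G X Y v = ¬ X v × (∀ u → X u → (E G v u → Y u) × (Y u → E G v u))

IsComponent : ∀ {n} → Graph n → (R : Fin n → Set) → Subset n → Set
IsComponent G R Kc =
  Nonempty Kc ×
  (∀ v → v ∈ Kc → R v) ×
  Connected G Kc ×
  (∀ u w → u ∈ Kc → R w → E G u w → w ∈ Kc)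

AdjacentTo : ∀ {n} → Graph n → Subset n → Fin n → Set
AdjacentTo G Kc v = ∃[ w ] (w ∈ Kc × E G w v)

AtMost : ∀ {n} → ℕ → (Fin n → Set) → Set
AtMost {n} k P = ¬ (Σ (Fin (Data.Nat.suc k) → Fin n) λ f → Injective _≡_ _≡_ f × (∀ i → P (f i)))

-- The three sets {x}, {x'} and the component K are pairwise disjoint, nonempty and
-- connected, and every vertex of C is adjacent to all three of them (to x and x' by the
-- definition of C, to K by assumption) while lying outside them (C avoids X ∋ x, x' and
-- K avoids C).  So r distinct vertices of C adjacent to K, taken as singleton branch
-- sets, complete a K_{3,r} minor model.
module Submission where

open import Defs
open import Data.Nat using (ℕ; _+_; _≤_; _∸_; suc; s≤s; z≤n)
open import Data.Bool using (Bool; true; false; _xor_)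
open import Data.Fin using (Fin; zero; suc; splitAt; join)
open import Data.Fin.Properties using (join-splitAt)
open import Data.Fin.Subset using (Subset; _∈_; _∉_; _∪_; ⁅_⁆; Nonempty)
open import Data.Fin.Subset.Properties using (x∈⁅x⁆; x∈⁅y⁆⇒x≡y)
open import Data.Product using (_×_; _,_; proj₁; proj₂; ∃-syntax)
open import Data.Sum using (_⊎_; inj₁; inj₂)
open import Function.Definitions using (Injective)
open import Relation.Binary.PropositionalEquality
  using (_≡_; _≢_; refl; sym; trans; cong; module ≡-Reasoning)
open import Relation.Nullary using (¬_)

splitAt-injective : ∀ a {b} → Injective _≡_ _≡_ (splitAt a {b})
splitAt-injective a {b} {i} {j} eq = begin
  i                      ≡⟨ join-splitAt a b i ⟨
  join a b (splitAt a i) ≡⟨ cong (join a b) eq ⟩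
  join a b (splitAt a j) ≡⟨ join-splitAt a b j ⟩
  j                      ∎
  where open ≡-Reasoning

isLeft : ∀ {A B : Set} → A ⊎ B → Bool
isLeft (inj₁ _) = true
isLeft (inj₂ _) = false

side-splitAt : ∀ a {b} (i : Fin (a + b)) → side a i ≡ isLeft (splitAt a i)
side-splitAt a i with splitAt a i
... | inj₁ _ = refl
... | inj₂ _ = refl

⁅⁆-nonempty : ∀ {n} (v : Fin n) → Nonempty ⁅ v ⁆
⁅⁆-nonempty v = v , x∈⁅x⁆ v

module _ {n : ℕ} (G : Graph n) where

  inClass⇒≢ : ∀ {X Y v u} → InClass G X Y v → X u → v ≢ u
  inClass⇒≢ (v∉X , _) u∈X refl = v∉X u∈X

  inClass⇒adjacent : ∀ {X Y v u} → InClass G X Y v → X u → Y u → E G u v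
  inClass⇒adjacent {v = v} {u} (_ , N[v]∩X≡Y) u∈X u∈Y =
    trans (adj-sym G u v) (proj₂ (N[v]∩X≡Y u u∈X) u∈Y)

  ⁅⁆-connected : ∀ v → Connected G ⁅ v ⁆
  ⁅⁆-connected v u w u∈ w∈ with x∈⁅y⁆⇒x≡y v u∈ | x∈⁅y⁆⇒x≡y v w∈
  ... | refl | refl = here (x∈⁅x⁆ v)

  adjacentTo-⁅⁆ : ∀ {u v} → E G u v → AdjacentTo G ⁅ u ⁆ v
  adjacentTo-⁅⁆ {u} e = u , x∈⁅x⁆ u , e

  K-minor-from-common-neighbours : ∀ {a b} (A : Fin a → Subset n) (c : Fin b → Fin n) →
    (∀ i → Nonempty (A i)) → (∀ i → Connected G (A i)) →
    (∀ i i' → i ≢ i' → ∀ v → v ∈ A i → v ∉ A i') →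
    Injective _≡_ _≡_ c → (∀ j i → c j ∉ A i) → (∀ j i → AdjacentTo G (A i) (c j)) →
    HasMinor (K a b) G
  K-minor-from-common-neighbours {a} {b} A c A-nonempty A-connected A-disjoint
                                 c-injective c∉A c-adjacent = record
    { branch    = λ i → branch (splitAt a i)
    ; nonempty  = λ i → branch-nonempty (splitAt a i)
    ; connected = λ i → branch-connected (splitAt a i)
    ; disjoint  = λ i j i≢j → branch-disjoint (splitAt a i) (splitAt a j)
                                (λ eq → i≢j (splitAt-injective a eq))
    ; edges     = λ i j e → branch-edges (splitAt a i) (splitAt a j)
                    (edge-splitAt i j e)
    }
    where
    branch : Fin a ⊎ Fin b → Subset n
    branch (inj₁ i) = A i
    branch (inj₂ j) = ⁅ c j ⁆

    branch-nonempty : ∀ s → Nonempty (branch s)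
    branch-nonempty (inj₁ i) = A-nonempty i
    branch-nonempty (inj₂ j) = ⁅⁆-nonempty (c j)

    branch-connected : ∀ s → Connected G (branch s)
    branch-connected (inj₁ i) = A-connected i
    branch-connected (inj₂ j) = ⁅⁆-connected (c j)

    branch-disjoint : ∀ s t → s ≢ t → ∀ v → v ∈ branch s → v ∉ branch t
    branch-disjoint (inj₁ i) (inj₁ i') s≢t v v∈ = A-disjoint i i' (λ eq → s≢t (cong inj₁ eq)) v v∈
    branch-disjoint (inj₁ i) (inj₂ j)  _   v v∈ v∈' with x∈⁅y⁆⇒x≡y (c j) v∈'
    ... | refl = c∉A j i v∈
    branch-disjoint (inj₂ j) (inj₁ i)  _   v v∈ v∈' with x∈⁅y⁆⇒x≡y (c j) v∈
    ... | refl = c∉A j i v∈'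
    branch-disjoint (inj₂ j) (inj₂ j') s≢t v v∈ v∈' =
      s≢t (cong inj₂ (c-injective (trans (sym (x∈⁅y⁆⇒x≡y (c j) v∈)) (x∈⁅y⁆⇒x≡y (c j') v∈'))))

    branch-edges : ∀ s t → isLeft s xor isLeft t ≡ true →
                   ∃[ u ] ∃[ v ] (u ∈ branch s × v ∈ branch t × E G u v)
    branch-edges (inj₁ i) (inj₂ j) _ with c-adjacent j i
    ... | u , u∈ , e = u , c j , u∈ , x∈⁅x⁆ (c j) , e
    branch-edges (inj₂ j) (inj₁ i) _ with c-adjacent j i
    ... | u , u∈ , e = c j , u , x∈⁅x⁆ (c j) , u∈ , trans (adj-sym G (c j) u) e

    edge-splitAt : ∀ i j → E (K a b) i j → isLeft (splitAt a i) xor isLeft (splitAt a j) ≡ true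
    edge-splitAt i j e rewrite side-splitAt a {b} i | side-splitAt a {b} j = e

  K-3-minor-from-two-vertices-and-set :
    ∀ {r} {x x' : Fin n} {S : Subset n} (c : Fin r → Fin n) →
    x ≢ x' → x ∉ S → x' ∉ S → Nonempty S → Connected G S → Injective _≡_ _≡_ c →
    (∀ j → c j ≢ x) → (∀ j → c j ≢ x') → (∀ j → c j ∉ S) →
    (∀ j → E G x (c j)) → (∀ j → E G x' (c j)) → (∀ j → AdjacentTo G S (c j)) →
    HasMinor (K 3 r) G
  K-3-minor-from-two-vertices-and-set {x = x} {x'} {S} c x≢x' x∉S x'∉S S-nonempty S-connected
                                      c-injective c≢x c≢x' c∉S x~c x'~c S~c =
    K-minor-from-common-neighbours A c A-nonempty A-connected A-disjoint
                                   c-injective c∉A c-adjacent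
    where
    A : Fin 3 → Subset n
    A zero             = ⁅ x ⁆
    A (suc zero)       = ⁅ x' ⁆
    A (suc (suc zero)) = S

    A-nonempty : ∀ i → Nonempty (A i)
    A-nonempty zero             = ⁅⁆-nonempty x
    A-nonempty (suc zero)       = ⁅⁆-nonempty x'
    A-nonempty (suc (suc zero)) = S-nonempty

    A-connected : ∀ i → Connected G (A i)
    A-connected zero             = ⁅⁆-connected x
    A-connected (suc zero)       = ⁅⁆-connected x'
    A-connected (suc (suc zero)) = S-connected

    A-disjoint : ∀ i i' → i ≢ i' → ∀ v → v ∈ A i → v ∉ A i'
    A-disjoint zero             zero             i≢i' _ _ _ = i≢i' refl
    A-disjoint (suc zero)       (suc zero)       i≢i' _ _ _ = i≢i' refl
    A-disjoint (suc (suc zero)) (suc (suc zero)) i≢i' _ _ _ = i≢i' refl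
    A-disjoint zero             (suc zero)       _ v v≡x v≡x' =
      x≢x' (trans (sym (x∈⁅y⁆⇒x≡y x v≡x)) (x∈⁅y⁆⇒x≡y x' v≡x'))
    A-disjoint (suc zero)       zero             _ v v≡x' v≡x =
      x≢x' (trans (sym (x∈⁅y⁆⇒x≡y x v≡x)) (x∈⁅y⁆⇒x≡y x' v≡x'))
    A-disjoint zero             (suc (suc zero)) _ v v≡x v∈S with x∈⁅y⁆⇒x≡y x v≡x
    ... | refl = x∉S v∈S
    A-disjoint (suc (suc zero)) zero             _ v v∈S v≡x with x∈⁅y⁆⇒x≡y x v≡x
    ... | refl = x∉S v∈S
    A-disjoint (suc zero)       (suc (suc zero)) _ v v≡x' v∈S with x∈⁅y⁆⇒x≡y x' v≡x'
    ... | refl = x'∉S v∈S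
    A-disjoint (suc (suc zero)) (suc zero)       _ v v∈S v≡x' with x∈⁅y⁆⇒x≡y x' v≡x'
    ... | refl = x'∉S v∈S

    c∉A : ∀ j i → c j ∉ A i
    c∉A j zero             c≡x  = c≢x j (x∈⁅y⁆⇒x≡y x c≡x)
    c∉A j (suc zero)       c≡x' = c≢x' j (x∈⁅y⁆⇒x≡y x' c≡x')
    c∉A j (suc (suc zero)) = c∉S j

    c-adjacent : ∀ j i → AdjacentTo G (A i) (c j)
    c-adjacent j zero             = adjacentTo-⁅⁆ (x~c j)
    c-adjacent j (suc zero)       = adjacentTo-⁅⁆ (x'~c j)
    c-adjacent j (suc (suc zero)) = S~c j

mainTheorem9 : (r : ℕ) → 1 ≤ r → (n : ℕ) → (G : Graph n) → MinorFree (K 3 r) G →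
    (Is It : Subset n) → IndependentSet G Is → IndependentSet G It →
    (x x' : Fin n) → x ∈ (Is ∪ It) → x' ∈ (Is ∪ It) → x ≢ x' →
    (Kc : Subset n) →
    IsComponent G
      (λ v → ¬ InClass G (λ u → u ∈ (Is ∪ It)) (λ u → u ≡ x ⊎ u ≡ x') v × v ≢ x × v ≢ x')
      Kc →
    AtMost (r ∸ 1)
      (λ c → InClass G (λ u → u ∈ (Is ∪ It)) (λ u → u ≡ x ⊎ u ≡ x') c × AdjacentTo G Kc c)
mainTheorem9 (suc k) (s≤s z≤n) n G K₃ᵣ-free Is It _ _ x x' x∈X x'∈X x≢x' Kc
             (Kc-nonempty , Kc⊆R , Kc-connected , _) (c , c-injective , c∈C×adj) =
  K₃ᵣ-free (K-3-minor-from-two-vertices-and-set G c x≢x' x∉Kc x'∉Kc Kc-nonempty Kc-connected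
    c-injective (λ j → inClass⇒≢ G (c∈C j) x∈X) (λ j → inClass⇒≢ G (c∈C j) x'∈X)
    (λ j c∈Kc → proj₁ (Kc⊆R (c j) c∈Kc) (c∈C j))
    (λ j → inClass⇒adjacent G (c∈C j) x∈X (inj₁ refl))
    (λ j → inClass⇒adjacent G (c∈C j) x'∈X (inj₂ refl))
    (λ j → proj₂ (c∈C×adj j)))
  where
  c∈C : ∀ j → InClass G (λ u → u ∈ (Is ∪ It)) (λ u → u ≡ x ⊎ u ≡ x') (c j)
  c∈C j = proj₁ (c∈C×adj j)

  x∉Kc : x ∉ Kc
  x∉Kc x∈Kc = proj₁ (proj₂ (Kc⊆R x x∈Kc)) refl

  x'∉Kc : x' ∉ Kc
  x'∉Kc x'∈Kc = proj₂ (proj₂ (Kc⊆R x' x'∈Kc)) refl
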